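{- For any efficient domination graph $G$, $\gamma_{qtR}(G)\le 3\rho(G)$.
   Context: All graphs are finite, simple and undirected. A set $B\subseteq V(G)$ is a packing if $N[u]\cap N[v]=\emptyset$ for all distinct $u,v\in B$; $\rho(G)$ is the maximum size of a packing. $\gamma(G)$ is the domination number. An efficient domination graph is a graph $G$ with $\rho(G)=\gamma(G)$. For $f:V(G)\to\{0,1,2\}$ write $V_i=\{v:f(v)=i\}$, weight $\sum_v f(v)$. A quasi-total Roman dominating function (QTRDF) is a function $f:V(G)\to\{0,1,2\}$ such that every vertex $u$ with $f(u)=0$ is adjacent to some $v$ with $f(v)=2$, and every vertex $x$ that is isolated in the subgraph induced by $V_1\cup V_2$ satisfies $f(x)=1$. $\gamma_{qtR}(G)$ is the minimum weight of a QTRDF on $G$. -}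

module Defs where

open import Data.Nat using (ℕ; _≤_; _*_)
open import Data.Fin using (Fin; toℕ; zero; suc)
open import Data.Fin.Subset using (Subset; _∈_; ∣_∣)
open import Data.Vec using (tabulate; sum)
open import Data.Product using (Σ; _×_; ∃)
open import Data.Sum using (_⊎_)
open import Data.Empty using (⊥)
open import Relation.Nullary using (¬_; Dec)
open import Relation.Binary.PropositionalEquality using (_≡_; _≢_)

record Graph (n : ℕ) : Set₁ where
  field
    Adj    : Fin n → Fin n → Set
    sym    : ∀ {u v} → Adj u v → Adj v u
    irrefl : ∀ {u} → ¬ Adj u u
    adj?   : ∀ u v → Dec (Adj u v)
open Graph public

module _ {n : ℕ} (G : Graph n) where

  InClosedNbr : Fin n → Fin n → Set
  InClosedNbr u w = (u ≡ w) ⊎ Adj G u w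

  IsPacking : Subset n → Set
  IsPacking B = ∀ u v → u ∈ B → v ∈ B → u ≢ v →
                ∀ w → ¬ (InClosedNbr u w × InClosedNbr v w)

  IsPackingNumber : ℕ → Set
  IsPackingNumber k =
    (Σ (Subset n) λ B → IsPacking B × ∣ B ∣ ≡ k) ×
    (∀ B → IsPacking B → ∣ B ∣ ≤ k)

  IsDominating : Subset n → Set
  IsDominating D = ∀ v → (v ∈ D) ⊎ (∃ λ u → u ∈ D × Adj G u v)

  IsDominationNumber : ℕ → Set
  IsDominationNumber k =
    (Σ (Subset n) λ D → IsDominating D × ∣ D ∣ ≡ k) ×
    (∀ D → IsDominating D → k ≤ ∣ D ∣)

  IsEfficientDominationGraph : Set
  IsEfficientDominationGraph =
    Σ ℕ λ k → IsPackingNumber k × IsDominationNumber k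

  -- functions V(G) → {0,1,2}, encoded by Fin 3
  weight : (Fin n → Fin 3) → ℕ
  weight f = sum (tabulate (λ v → toℕ (f v)))

  IsQTRDF : (Fin n → Fin 3) → Set
  IsQTRDF f =
    (∀ u → f u ≡ zero → ∃ λ v → Adj G u v × f v ≡ suc (suc zero)) ×
    -- x ∈ V₁ ∪ V₂ isolated in the subgraph induced by V₁ ∪ V₂ ⇒ f x = 1
    (∀ x → f x ≢ zero → (∀ y → Adj G x y → f y ≡ zero) → f x ≡ suc zero)

  IsQTRNumber : ℕ → Set
  IsQTRNumber m =
    (Σ (Fin n → Fin 3) λ f → IsQTRDF f × weight f ≡ m) ×
    (∀ f → IsQTRDF f → m ≤ weight f)

-- In fact γ_qtR(G) ≤ 3 γ(G) for every graph, and ρ(G) = γ(G) only converts the bound. Take a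
-- minimum dominating set D, give 2 to each vertex of D with a neighbour and 1 to each isolated one,
-- and give 1 to one chosen neighbour of each non-isolated vertex of D if it is not in D. Every 0
-- lies outside D, hence next to a 2; every 2 has its chosen neighbour positive, so only 1s can be
-- isolated among the positive vertices. Each vertex of D pays at most 2 for itself and 1 for its
-- chosen neighbour.
module Submission where

open import Defs hiding (sym)
open import Data.Nat using (ℕ; zero; suc; _+_; _*_; _≤_; z≤n; s≤s)
open import Data.Nat.Properties
  using (+-*-semiring; +-comm; +-mono-≤; +-monoʳ-≤; m≤m+n; m≤n+m; ≤-trans; ≤-reflexive; module ≤-Reasoning)
open import Data.Bool using (if_then_else_)
open import Data.Fin using (Fin; toℕ; zero; suc)
open import Data.Fin.Properties using (any?)
open import Data.Fin.Subset using (Subset; _∈_; ∣_∣; ⁅_⁆; ⊥; inside; outside)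
open import Data.Fin.Subset.Properties using (_∈?_; x∈⁅x⁆; ∣⁅x⁆∣≡1; ∣⊥∣≡0)
open import Data.Vec as Vec using (_∷_; [])
open import Data.Product using (∃; _×_; _,_; proj₁; proj₂)
open import Data.Sum using (inj₁; inj₂)
open import Function using (_∘_)
open import Relation.Nullary using (¬_; Dec; yes; no; does; contradiction)
open import Relation.Nullary.Decidable using (dec-true)
open import Relation.Unary using (Pred; Decidable)
open import Relation.Binary.PropositionalEquality using (_≡_; _≢_; refl; sym; cong)
open import Algebra.Properties.Semiring.Sum +-*-semiring
  using (sum-syntax; sum-cong-≗; ∑-distrib-+; ∑-comm; *-distribˡ-sum)

𝟙 : ∀ {a} {A : Set a} → Dec A → ℕ
𝟙 a? = if does a? then 1 else 0

∑-mono-≤ : ∀ {n} {f g : Fin n → ℕ} → (∀ i → f i ≤ g i) → ∑[ i < n ] f i ≤ ∑[ i < n ] g i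
∑-mono-≤ {zero}  f≤g = z≤n
∑-mono-≤ {suc n} f≤g = +-mono-≤ (f≤g zero) (∑-mono-≤ (f≤g ∘ suc))

f≤∑f : ∀ {n} (f : Fin n → ℕ) i → f i ≤ ∑[ j < n ] f j
f≤∑f f zero    = m≤m+n _ _
f≤∑f f (suc i) = ≤-trans (f≤∑f (f ∘ suc) i) (m≤n+m _ _)

sum-tabulate : ∀ {n} (f : Fin n → ℕ) → Vec.sum (Vec.tabulate f) ≡ ∑[ i < n ] f i
sum-tabulate {zero}  f = refl
sum-tabulate {suc n} f = cong (f zero +_) (sum-tabulate (f ∘ suc))

∣p∣≡∑𝟙∈ : ∀ {n} (p : Subset n) → ∣ p ∣ ≡ ∑[ i < n ] 𝟙 (i ∈? p)
∣p∣≡∑𝟙∈ []            = refl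
∣p∣≡∑𝟙∈ (inside  ∷ p) = cong suc (∣p∣≡∑𝟙∈ p)
∣p∣≡∑𝟙∈ (outside ∷ p) = ∣p∣≡∑𝟙∈ p

𝟙-any?≤∑𝟙 : ∀ {n p} {P : Pred (Fin n) p} (P? : Decidable P) → 𝟙 (any? P?) ≤ ∑[ i < n ] 𝟙 (P? i)
𝟙-any?≤∑𝟙 P? with any? P?
... | yes (i , Pi) = ≤-trans (≤-reflexive (cong (if_then 1 else 0) (sym (dec-true (P? i) Pi)))) (f≤∑f (𝟙 ∘ P?) i)
... | no  _        = z≤n

∣⋃∣≤∑∣∣ : ∀ {m n} (A : Fin m → Subset n) →
          ∑[ v < n ] 𝟙 (any? (λ i → v ∈? A i)) ≤ ∑[ i < m ] ∣ A i ∣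
∣⋃∣≤∑∣∣ {m} {n} A = begin
  ∑[ v < n ] 𝟙 (any? (λ i → v ∈? A i))  ≤⟨ ∑-mono-≤ (λ v → 𝟙-any?≤∑𝟙 (λ i → v ∈? A i)) ⟩
  ∑[ v < n ] ∑[ i < m ] 𝟙 (v ∈? A i)    ≡⟨ ∑-comm (λ v i → 𝟙 (v ∈? A i)) ⟩
  ∑[ i < m ] ∑[ v < n ] 𝟙 (v ∈? A i)    ≡⟨ sum-cong-≗ (sym ∘ ∣p∣≡∑𝟙∈ ∘ A) ⟩
  ∑[ i < m ] ∣ A i ∣                     ∎
  where open ≤-Reasoning

module _ {a b c} {A : Set a} {B : Set b} {C : Set c} where

  qtrLevel : Dec A → Dec B → Dec C → Fin 3
  qtrLevel (yes _) (yes _) _       = suc (suc zero)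
  qtrLevel (yes _) (no _)  _       = suc zero
  qtrLevel (no _)  _       (yes _) = suc zero
  qtrLevel (no _)  _       (no _)  = zero

  qtrLevel≡2⇒ : ∀ a? b? (c? : Dec C) → qtrLevel a? b? c? ≡ suc (suc zero) → A × B
  qtrLevel≡2⇒ (yes a) (yes b) _       _  = a , b
  qtrLevel≡2⇒ (yes _) (no _)  _       ()
  qtrLevel≡2⇒ (no _)  _       (yes _) ()
  qtrLevel≡2⇒ (no _)  _       (no _)  ()

  qtrLevel≡0⇒ : ∀ a? (b? : Dec B) c? → qtrLevel a? b? c? ≡ zero → ¬ A × ¬ C
  qtrLevel≡0⇒ (yes _) (yes _) _       ()
  qtrLevel≡0⇒ (yes _) (no _)  _       ()
  qtrLevel≡0⇒ (no _)  _       (yes _) ()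
  qtrLevel≡0⇒ (no ¬a) _       (no ¬c) _  = ¬a , ¬c

  qtrLevel-yes-yes : ∀ a? b? (c? : Dec C) → A → B → qtrLevel a? b? c? ≡ suc (suc zero)
  qtrLevel-yes-yes (yes _) (yes _) _ _ _ = refl
  qtrLevel-yes-yes (yes _) (no ¬b) _ _ b = contradiction b ¬b
  qtrLevel-yes-yes (no ¬a) _       _ a _ = contradiction a ¬a

  toℕ-qtrLevel≤ : ∀ a? (b? : Dec B) c? → toℕ (qtrLevel a? b? c?) ≤ 2 * 𝟙 a? + 𝟙 c?
  toℕ-qtrLevel≤ (yes _) (yes _) _       = s≤s (s≤s z≤n)
  toℕ-qtrLevel≤ (yes _) (no _)  _       = s≤s z≤n
  toℕ-qtrLevel≤ (no _)  _       (yes _) = s≤s z≤n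
  toℕ-qtrLevel≤ (no _)  _       (no _)  = z≤n

module _ {a p} {n} {A : Set a} {P : Pred (Fin n) p} where

  chosenWitness : Dec A → Dec (∃ P) → Subset n
  chosenWitness (yes _) (yes (y , _)) = ⁅ y ⁆
  chosenWitness _       _             = ⊥

  ∣chosenWitness∣≤𝟙 : ∀ a? p? → ∣ chosenWitness a? p? ∣ ≤ 𝟙 a?
  ∣chosenWitness∣≤𝟙 (yes _) (yes (y , _)) = ≤-reflexive (∣⁅x⁆∣≡1 y)
  ∣chosenWitness∣≤𝟙 (yes _) (no _)        = ≤-trans (≤-reflexive (∣⊥∣≡0 n)) z≤n
  ∣chosenWitness∣≤𝟙 (no _)  _             = ≤-reflexive (∣⊥∣≡0 n)

  chosenWitness-spec : ∀ a? p? → A → ∃ P → ∃ λ y → P y × y ∈ chosenWitness a? p?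
  chosenWitness-spec (yes _) (yes (y , Py)) _ _  = y , Py , x∈⁅x⁆ y
  chosenWitness-spec (yes _) (no ¬p)        _ p  = contradiction p ¬p
  chosenWitness-spec (no ¬a) _              a _  = contradiction a ¬a

module FromDominatingSet {n} (G : Graph n) (D : Subset n) (D-dominating : IsDominating G D) where

  hasNeighbour? : ∀ v → Dec (∃ (Adj G v))
  hasNeighbour? v = any? (adj? G v)

  partner : Fin n → Subset n
  partner d = chosenWitness (d ∈? D) (hasNeighbour? d)

  isPartner? : ∀ v → Dec (∃ λ d → v ∈ partner d)
  isPartner? v = any? (λ d → v ∈? partner d)

  f : Fin n → Fin 3
  f v = qtrLevel (v ∈? D) (hasNeighbour? v) (isPartner? v)

  f-isQTRDF : IsQTRDF G f
  f-isQTRDF = zero⇒adjacent-two , positive-isolated⇒one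
    where
    zero⇒adjacent-two : ∀ u → f u ≡ zero → ∃ λ v → Adj G u v × f v ≡ suc (suc zero)
    zero⇒adjacent-two u fu≡0 with D-dominating u
    ... | inj₁ u∈D               = contradiction u∈D (proj₁ (qtrLevel≡0⇒ _ _ _ fu≡0))
    ... | inj₂ (d , d∈D , d~u) = d , Graph.sym G d~u , qtrLevel-yes-yes _ _ _ d∈D (u , d~u)

    positive-isolated⇒one : ∀ x → f x ≢ zero → (∀ y → Adj G x y → f y ≡ zero) → f x ≡ suc zero
    positive-isolated⇒one x fx≢0 isolated with f x in fx≡
    ... | zero           = contradiction refl fx≢0
    ... | suc zero       = refl
    ... | suc (suc zero) with qtrLevel≡2⇒ _ _ _ fx≡
    ...   | x∈D , x-nonisolated with chosenWitness-spec (x ∈? D) (hasNeighbour? x) x∈D x-nonisolated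
    ...     | y , x~y , y∈partner-x =
      contradiction (x , y∈partner-x) (proj₂ (qtrLevel≡0⇒ _ _ _ (isolated y x~y)))

  weight-f≤3∣D∣ : weight G f ≤ 3 * ∣ D ∣
  weight-f≤3∣D∣ = begin
    weight G f                                          ≡⟨ sum-tabulate (toℕ ∘ f) ⟩
    ∑[ v < n ] toℕ (f v)                                ≤⟨ ∑-mono-≤ (λ v → toℕ-qtrLevel≤ (v ∈? D) (hasNeighbour? v) (isPartner? v)) ⟩
    ∑[ v < n ] (2 * 𝟙 (v ∈? D) + 𝟙 (isPartner? v))      ≡⟨ ∑-distrib-+ (λ v → 2 * 𝟙 (v ∈? D)) (𝟙 ∘ isPartner?) ⟩
    ∑[ v < n ] (2 * 𝟙 (v ∈? D)) + ∑[ v < n ] 𝟙 (isPartner? v)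
      ≤⟨ +-mono-≤ (≤-reflexive (sym (*-distribˡ-sum 2 (λ v → 𝟙 (v ∈? D))))) (∣⋃∣≤∑∣∣ partner) ⟩
    2 * ∑[ v < n ] 𝟙 (v ∈? D) + ∑[ d < n ] ∣ partner d ∣
      ≤⟨ +-monoʳ-≤ (2 * ∑[ v < n ] 𝟙 (v ∈? D)) (∑-mono-≤ (λ d → ∣chosenWitness∣≤𝟙 (d ∈? D) (hasNeighbour? d))) ⟩
    2 * ∑[ v < n ] 𝟙 (v ∈? D) + ∑[ v < n ] 𝟙 (v ∈? D)  ≡⟨ cong (λ s → 2 * s + s) (sym (∣p∣≡∑𝟙∈ D)) ⟩
    2 * ∣ D ∣ + ∣ D ∣                                   ≡⟨ +-comm (2 * ∣ D ∣) ∣ D ∣ ⟩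
    3 * ∣ D ∣                                           ∎
    where open ≤-Reasoning

mainTheorem9 : (n : ℕ) (G : Graph n) (k : ℕ) →
    IsPackingNumber G k → IsDominationNumber G k →
    (m : ℕ) → IsQTRNumber G m → m ≤ 3 * k
mainTheorem9 n G k _ ((D , D-dominating , ∣D∣≡k) , _) m (_ , m-minimal) = begin
  m          ≤⟨ m-minimal f f-isQTRDF ⟩
  weight G f ≤⟨ weight-f≤3∣D∣ ⟩
  3 * ∣ D ∣  ≡⟨ cong (3 *_) ∣D∣≡k ⟩
  3 * k      ∎
  where
  open FromDominatingSet G D D-dominating
  open ≤-Reasoning
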